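{- Let $C_n\in\mathbb{Z}/2[t]$ ($n\ge0$) be defined by $C_0=0$, $C_1=1$, $C_2=t$, $C_3=t^2$ and $C_{n+4}=C_{n+3}+(t^4+t^3+t^2+t)C_n+t^n(t^2+t)$. If, for some $n\ge 0$, $C_n$ is a $\mathbb{Z}/2$-linear combination of the $C_k$ with $k<n$, then $4$ divides $n$.
   Context: $\mathbb{Z}/2[t]$ is the polynomial ring over the field with two elements. -}

module Defs where

open import Data.Nat using (ℕ; zero; suc; _+_)
open import Data.Bool using (Bool; true; false; _xor_; _∧_)
open import Relation.Binary.PropositionalEquality using (_≡_)

-- A polynomial over Z/2 is represented by its coefficient function
-- (coefficient of t^i); all polynomials below have finite support.
Poly : Set
Poly = ℕ → Bool

_≈P_ : Poly → Poly → Set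
f ≈P g = ∀ i → f i ≡ g i

0P : Poly
0P _ = false

_⊕_ : Poly → Poly → Poly
(f ⊕ g) i = f i xor g i

shift : Poly → Poly
shift f zero = false
shift f (suc i) = f i

mono : ℕ → Poly
mono zero zero = true
mono zero (suc i) = false
mono (suc n) zero = false
mono (suc n) (suc i) = mono n i

scale : Bool → Poly → Poly
scale b f i = b ∧ f i

mulQ : Poly → Poly
mulQ f = shift (shift (shift (shift f))) ⊕ (shift (shift (shift f)) ⊕ (shift (shift f) ⊕ shift f))

C : ℕ → Poly
C zero = 0P
C (suc zero) = mono 0
C (suc (suc zero)) = mono 1
C (suc (suc (suc zero))) = mono 2
C (suc (suc (suc (suc n)))) =
  C (suc (suc (suc n))) ⊕ (mulQ (C n) ⊕ (mono (n + 2) ⊕ mono (n + 1)))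

linComb : ℕ → (ℕ → Bool) → Poly
linComb zero c = 0P
linComb (suc n) c = linComb n c ⊕ scale (c n) (C n)

{-# OPTIONS --safe #-}
module Submission where

-- Every C_n has degree < n, and the coefficient of t^(n-1) in C_n, for n ≥ 1, is
-- periodic with period 4 (in the recurrence for C_(n+4) only the t^4 C_n term
-- reaches t^(n+3)), with values 1, 1, 1, 0 for n ≡ 1, 2, 3, 0 (mod 4).
-- A combination of C_0, …, C_(n-1) has degree < n - 1, so if it equals C_n
-- that coefficient vanishes and 4 ∣ n.

open import Data.Nat using (ℕ; zero; suc; _+_; _≤_; s≤s)
open import Data.Nat.Properties using (≤-refl; ≤-trans; ≤-reflexive; m≤n⇒m≤1+n; n≤1+n; +-comm)
open import Data.Nat.Divisibility using (_∣_; divides)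
open import Data.Bool using (Bool; false; _xor_; _∧_)
open import Data.Bool.Properties using (xor-identityʳ; ∧-zeroʳ)
open import Data.Product using (∃; _,_)
open import Relation.Binary.PropositionalEquality using (_≡_; refl; sym; trans; cong; cong₂; module ≡-Reasoning)
open import Defs

DegreeBelow : ℕ → Poly → Set
DegreeBelow n f = ∀ i → n ≤ i → f i ≡ false

degreeBelow-mono : ∀ {m n f} → m ≤ n → DegreeBelow m f → DegreeBelow n f
degreeBelow-mono m≤n d i n≤i = d i (≤-trans m≤n n≤i)

0P-degreeBelow : DegreeBelow 0 0P
0P-degreeBelow _ _ = refl

⊕-degreeBelow : ∀ {n f g} → DegreeBelow n f → DegreeBelow n g → DegreeBelow n (f ⊕ g)
⊕-degreeBelow df dg i n≤i = cong₂ _xor_ (df i n≤i) (dg i n≤i)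

scale-degreeBelow : ∀ {n} b {f} → DegreeBelow n f → DegreeBelow n (scale b f)
scale-degreeBelow b df i n≤i = trans (cong (b ∧_) (df i n≤i)) (∧-zeroʳ b)

shift-degreeBelow : ∀ {n f} → DegreeBelow n f → DegreeBelow (suc n) (shift f)
shift-degreeBelow df (suc i) (s≤s n≤i) = df i n≤i

mulQ-degreeBelow : ∀ {n f} → DegreeBelow n f → DegreeBelow (4 + n) (mulQ f)
mulQ-degreeBelow {n} {f} df =
  ⊕-degreeBelow t⁴f (degreeBelow-mono (n≤1+n (3 + n))
    (⊕-degreeBelow t³f (degreeBelow-mono (n≤1+n (2 + n))
      (⊕-degreeBelow t²f (degreeBelow-mono (n≤1+n (1 + n)) tf)))))
  where
  tf : DegreeBelow (1 + n) (shift f)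
  tf = shift-degreeBelow df
  t²f : DegreeBelow (2 + n) (shift (shift f))
  t²f = shift-degreeBelow tf
  t³f : DegreeBelow (3 + n) (shift (shift (shift f)))
  t³f = shift-degreeBelow t²f
  t⁴f : DegreeBelow (4 + n) (shift (shift (shift (shift f))))
  t⁴f = shift-degreeBelow t³f

mono-degreeBelow : ∀ n → DegreeBelow (suc n) (mono n)
mono-degreeBelow zero (suc i) _ = refl
mono-degreeBelow (suc n) (suc i) (s≤s n<i) = mono-degreeBelow n i n<i

C-degreeBelow : ∀ n → DegreeBelow n (C n)
C-degreeBelow 0 = 0P-degreeBelow
C-degreeBelow 1 = mono-degreeBelow 0
C-degreeBelow 2 = mono-degreeBelow 1
C-degreeBelow 3 = mono-degreeBelow 2
C-degreeBelow (suc (suc (suc (suc m)))) =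
  ⊕-degreeBelow (degreeBelow-mono (n≤1+n _) (C-degreeBelow (suc (suc (suc m)))))
    (⊕-degreeBelow (mulQ-degreeBelow (C-degreeBelow m))
      (⊕-degreeBelow (degreeBelow-mono m+3≤4+m (mono-degreeBelow (m + 2)))
        (degreeBelow-mono (≤-trans m+2≤3+m (n≤1+n _)) (mono-degreeBelow (m + 1)))))
  where
  m+3≤4+m : suc (m + 2) ≤ 4 + m
  m+3≤4+m = m≤n⇒m≤1+n (≤-reflexive (cong suc (+-comm m 2)))
  m+2≤3+m : suc (m + 1) ≤ 3 + m
  m+2≤3+m = m≤n⇒m≤1+n (≤-reflexive (cong suc (+-comm m 1)))

linComb-degreeBelow : ∀ m c → DegreeBelow m (linComb (suc m) c)
linComb-degreeBelow zero c = ⊕-degreeBelow 0P-degreeBelow (scale-degreeBelow (c 0) (C-degreeBelow 0))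
linComb-degreeBelow (suc m) c =
  ⊕-degreeBelow (degreeBelow-mono (n≤1+n m) (linComb-degreeBelow m c))
    (scale-degreeBelow (c (suc m)) (C-degreeBelow (suc m)))

mulQ-top : ∀ {k f} → DegreeBelow (suc k) f → mulQ f (4 + k) ≡ f k
mulQ-top {k} {f} df = begin
  f k xor (f (1 + k) xor (f (2 + k) xor f (3 + k)))
    ≡⟨ cong (f k xor_) (cong₂ _xor_ (df _ ≤-refl) (cong₂ _xor_ (df _ (n≤1+n _)) (df _ (≤-trans (n≤1+n _) (n≤1+n _))))) ⟩
  f k xor false
    ≡⟨ xor-identityʳ (f k) ⟩
  f k ∎
  where open ≡-Reasoning

C-top-period : ∀ k → C (5 + k) (4 + k) ≡ C (1 + k) k
C-top-period k = begin
  C (5 + k) (4 + k)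
    ≡⟨ cong₂ _xor_ (C-degreeBelow (4 + k) _ ≤-refl)
         (cong₂ _xor_ (mulQ-top (C-degreeBelow (1 + k)))
           (cong₂ _xor_ (mono-degreeBelow (suc k + 2) _ k+4≤4+k)
                        (mono-degreeBelow (suc k + 1) _ k+3≤4+k))) ⟩
  C (1 + k) k xor false
    ≡⟨ xor-identityʳ _ ⟩
  C (1 + k) k ∎
  where
  open ≡-Reasoning
  k+4≤4+k : suc (suc k + 2) ≤ 4 + k
  k+4≤4+k = ≤-reflexive (cong (2 +_) (+-comm k 2))
  k+3≤4+k : suc (suc k + 1) ≤ 4 + k
  k+3≤4+k = m≤n⇒m≤1+n (≤-reflexive (cong (2 +_) (+-comm k 1)))

C-top-vanishes⇒4∣ : ∀ m → C (suc m) m ≡ false → 4 ∣ suc m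
C-top-vanishes⇒4∣ 0 ()
C-top-vanishes⇒4∣ 1 ()
C-top-vanishes⇒4∣ 2 ()
C-top-vanishes⇒4∣ 3 _ = divides 1 refl
C-top-vanishes⇒4∣ (suc (suc (suc (suc k)))) top≡false
  with divides q eq ← C-top-vanishes⇒4∣ k (trans (sym (C-top-period k)) top≡false)
  = divides (suc q) (cong (4 +_) eq)

lemma1p9 : (n : ℕ) → (∃ λ (c : ℕ → Bool) → C n ≈P linComb n c) → 4 ∣ n
lemma1p9 zero _ = divides 0 refl
lemma1p9 (suc m) (c , C≈lc) = C-top-vanishes⇒4∣ m (trans (C≈lc m) (linComb-degreeBelow m c m ≤-refl))
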